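{- Let $(\mathcal{M},\boldsymbol\gamma)$ be a weighted binary matroid with a distinguished element $p$ that is not a loop. Then there is a weight $d\ge0$ such that, for every weight function $\boldsymbol\delta$ on $\{p,e\}$ with $\delta_e=d$, $$\frac{\tilde Z(\mathcal{I}_2/p;\boldsymbol\delta)}{\tilde Z(\mathcal{I}_2\backslash p;\boldsymbol\delta)}=\frac{\tilde Z(\mathcal{M}/p;\boldsymbol\gamma)}{\tilde Z(\mathcal{M}\backslash p;\boldsymbol\gamma)}.$$ Moreover, $d$ can be computed from $\tilde Z(\mathcal{M}\backslash p;\boldsymbol\gamma)$ and $\tilde Z(\mathcal{M}/p;\boldsymbol\gamma)$ alone (it does not otherwise depend on $\mathcal{M}$ or $\boldsymbol\gamma$).
   Context: $\mathcal{I}_2$ is the matroid on the two-element ground set $\{p,e\}$ in which $\{p,e\}$ is a circuit (the cycle matroid of two parallel edges). A weighted matroid has non-negative weights; $\tilde Z(\mathcal{N};\boldsymbol\gamma)=\sum_{A\subseteq E(\mathcal{N})}\gamma_A2^{ -r_{\mathcal{N}}(A)}$ with $\gamma_A=\prod_{e\in A}\gamma_e$. A loop is a one-element circuit. $\mathcal{M}\backslash p$ (deletion) is the matroid on $E-\{p\}$ with the restricted rank function; $\mathcal{M}/p$ (contraction) has rank function $r(A)=r_{\mathcal{M}}(A\cup\{p\})-r_{\mathcal{M}}(\{p\})$.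
   Formalization: The weights $\boldsymbol\gamma$ and $\boldsymbol\delta$ take rational values instead of real ones, and the weight d is likewise taken in the rationals. -}

module Defs where

open import Data.Bool using (Bool; true; false; if_then_else_; _xor_; _∧_; _∨_; not)
open import Data.Nat as ℕ using (ℕ; zero; suc; _∸_; _⊔_)
open import Data.Fin using (Fin; punchIn) renaming (zero to fzero; suc to fsuc)
open import Data.Fin.Subset using (Subset; ⁅_⁆; ∣_∣; _⊆_; ⊥)
open import Data.Vec using (Vec; []; _∷_; replicate; insertAt; lookup; map; zipWith)
open import Data.List as L using (List; [_]; _++_)
open import Data.Rational using (ℚ; 0ℚ; 1ℚ; ½; _*_; _+_; _≟_; _÷_; ≢-nonZero)
open import Relation.Nullary using (¬_; yes; no)
open import Relation.Binary.PropositionalEquality using (_≡_; _≢_)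
open import Data.Product using (_×_)

allSubsets : (n : ℕ) → List (Subset n)
allSubsets zero    = [ [] ]
allSubsets (suc n) = L.map (false ∷_) (allSubsets n) ++ L.map (true ∷_) (allSubsets n)

subsetB : ∀ {n} → Subset n → Subset n → Bool
subsetB []      []      = true
subsetB (c ∷ C) (b ∷ B) = (not c ∨ b) ∧ subsetB C B

nonemptyB : ∀ {n} → Subset n → Bool
nonemptyB []      = false
nonemptyB (c ∷ C) = c ∨ nonemptyB C

-- Binary matroids: given by a representation over GF(2) = Bool
-- (with xor as addition); the element i ∈ Fin n is the column col i ∈ GF(2)^m.

isZeroB : ∀ {m} → Vec Bool m → Bool
isZeroB []      = true
isZeroB (x ∷ v) = not x ∧ isZeroB v

colSum : ∀ {m n} → (Fin n → Vec Bool m) → Subset n → Vec Bool m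
colSum {m} {zero}  col []      = replicate m false
colSum {m} {suc n} col (c ∷ C) =
  zipWith _xor_ (if c then col fzero else replicate m false) (colSum (λ i → col (fsuc i)) C)

-- B is linearly independent over GF(2): no nonempty C ⊆ B has columns summing to 0
-- (over GF(2) a linear combination is exactly a subset sum)
independentB : ∀ {m n} → (Fin n → Vec Bool m) → Subset n → Bool
independentB {n = n} col B =
  L.foldr _∧_ true
    (L.map (λ C → not (subsetB C B ∧ nonemptyB C ∧ isZeroB (colSum col C))) (allSubsets n))

binRank : ∀ {m n} → (Fin n → Vec Bool m) → Subset n → ℕ
binRank {n = n} col A =
  L.foldr _⊔_ 0
    (L.map ∣_∣ (L.filterᵇ (λ B → subsetB B A ∧ independentB col B) (allSubsets n)))

Independent : ∀ {n} → (Subset n → ℕ) → Subset n → Set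
Independent r X = r X ≡ ∣ X ∣

IsCircuit : ∀ {n} → (Subset n → ℕ) → Subset n → Set
IsCircuit r C = ¬ Independent r C × (∀ D → D ⊆ C → D ≢ C → Independent r D)

IsLoop : ∀ {n} → (Subset n → ℕ) → Fin n → Set
IsLoop r p = IsCircuit r ⁅ p ⁆

-- Deletion and contraction of p ∈ Fin (suc n); the ground set E - {p} is
-- identified with Fin n via punchIn p, and a subset A of it corresponds to
-- insertAt A p false (its image in E).
deleteR : ∀ {n} → (Subset (suc n) → ℕ) → Fin (suc n) → Subset n → ℕ
deleteR r p A = r (insertAt A p false)

contractR : ∀ {n} → (Subset (suc n) → ℕ) → Fin (suc n) → Subset n → ℕ
contractR r p A = r (insertAt A p true) ∸ r ⁅ p ⁆

restrictW : ∀ {n} → (Fin (suc n) → ℚ) → Fin (suc n) → Fin n → ℚ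
restrictW γ p i = γ (punchIn p i)

-- The matroid I₂ on {p, e} = Fin 2 (p = 0, e = 1) with {p,e} a circuit

I₂p : Fin 2
I₂p = fzero

I₂e : Fin 2
I₂e = fsuc fzero

rankI₂ : Subset 2 → ℕ
rankI₂ (false ∷ false ∷ []) = 0
rankI₂ _                    = 1

weightOf : ∀ {n} → (Fin n → ℚ) → Subset n → ℚ
weightOf γ []      = 1ℚ
weightOf γ (a ∷ A) = (if a then γ fzero else 1ℚ) * weightOf (λ i → γ (fsuc i)) A

halfPow : ℕ → ℚ
halfPow zero    = 1ℚ
halfPow (suc k) = ½ * halfPow k

Ztilde : ∀ {n} → (Subset n → ℕ) → (Fin n → ℚ) → ℚ
Ztilde {n} r γ = L.foldr _+_ 0ℚ (L.map (λ A → weightOf γ A * halfPow (r A)) (allSubsets n))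

-- total division on ℚ (x / 0 := 0; only used with nonzero denominators)
_divℚ_ : ℚ → ℚ → ℚ
x divℚ y with y ≟ 0ℚ
... | yes _  = 0ℚ
... | no y≢0 = _÷_ x y {{≢-nonZero y≢0}}

module Submission where

-- As p is not a loop, adding p to a set A ⊆ E - p raises its rank by 0 or 1, so every
-- summand of Z̃(M/p) is the matching summand of Z̃(M\p) or twice it, the two being
-- equal (to 1) at A = ∅. Hence D = Z̃(M\p) and C = Z̃(M/p) satisfy D ≤ C < 2D.
-- For I₂ the two functions are 1 + δₑ and 1 + δₑ/2, and d = 2(C - D)/(2D - C) is a
-- non-negative solution of (1 + d)/(1 + d/2) = C/D.

open import Defs
open import Data.Bool using (Bool; true; false; if_then_else_; _∧_; _∨_; not)
open import Data.Bool.Properties using (∧-conicalˡ; ∧-conicalʳ)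
open import Data.Bool.ListAction using (and)
open import Data.Nat as ℕ using (ℕ; zero; suc; _⊔_; _∸_; z≤n; s≤s)
import Data.Nat.Properties as ℕ
open import Data.Fin using (Fin; punchIn) renaming (zero to fzero; suc to fsuc)
open import Data.Fin.Subset using (Subset; ⁅_⁆; ∣_∣; _⊆_; ⊥; _∈_)
open import Data.Fin.Subset.Properties using (∣⊥∣≡0; ∣⁅x⁆∣≡1; x∈⁅y⁆⇒x≡y; ⊆-antisym; Empty-unique; _∈?_)
open import Data.Vec using (Vec; []; _∷_; insertAt; _[_]≔_)
open import Data.List as List using (List; []; _∷_)
import Data.List.Membership.Propositional as List
open import Data.List.Membership.Propositional.Properties using (∈-map⁺; ∈-++⁺ˡ; ∈-++⁺ʳ)
open import Data.List.Relation.Unary.Any using (here; there)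
open import Data.Rational using (ℚ; 0ℚ; 1ℚ; ½; _+_; _*_; _-_; -_; 1/_; _≤_; _<_; _≟_; _<?_; ≢-nonZero; positive; nonNegative)
open import Data.Rational.Properties
  using (≤-refl; ≤-reflexive; <⇒≢; +-mono-≤; +-mono-<-≤; +-mono-≤-<; +-monoˡ-≤; +-monoʳ-≤; +-monoˡ-<; +-identityʳ; +-inverseʳ;
         *-assoc; *-identityʳ; *-zeroˡ; *-inverseˡ; *-inverseʳ; positive⁻¹; nonNegative⁻¹; pos⇒nonNeg; 1/pos⇒pos;
         nonNeg*nonNeg⇒nonNeg; module ≤-Reasoning)
open import Data.Rational.Solver using (module +-*-Solver)
open import Data.Product using (Σ; _×_; _,_; proj₁; proj₂)
open import Data.Sum using (inj₁; inj₂)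
open import Data.Empty using (⊥-elim)
open import Function using (_∘_)
open import Relation.Nullary using (¬_; yes; no; contradiction)
open import Relation.Nullary.Decidable using (from-yes)
open import Relation.Binary.PropositionalEquality
open +-*-Solver using (solve; _:=_; _:+_; _:*_; _:-_; con)

*-nonNeg : ∀ {x y} → 0ℚ ≤ x → 0ℚ ≤ y → 0ℚ ≤ x * y
*-nonNeg {x} {y} x≥0 y≥0 = nonNegative⁻¹ (x * y) {{nonNeg*nonNeg⇒nonNeg x {{nonNegative x≥0}} y {{nonNegative y≥0}}}}

divℚ-*ʳ : ∀ x y → y ≢ 0ℚ → (x divℚ y) * y ≡ x
divℚ-*ʳ x y y≢0 with y ≟ 0ℚ
... | yes y≡0 = ⊥-elim (y≢0 y≡0)
... | no y≢0′ = begin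
  x * (1/ y) * y   ≡⟨ *-assoc x _ y ⟩
  x * ((1/ y) * y) ≡⟨ cong (x *_) (*-inverseˡ y) ⟩
  x * 1ℚ           ≡⟨ *-identityʳ x ⟩
  x                ∎
  where
  open ≡-Reasoning
  instance _ = ≢-nonZero y≢0′

divℚ-cross : ∀ x y u v → y ≢ 0ℚ → v ≢ 0ℚ → x * v ≡ u * y → x divℚ y ≡ u divℚ v
divℚ-cross x y u v y≢0 v≢0 xv≡uy with y ≟ 0ℚ | v ≟ 0ℚ
... | yes y≡0 | _       = ⊥-elim (y≢0 y≡0)
... | no _    | yes v≡0 = ⊥-elim (v≢0 v≡0)
... | no y≢0′ | no v≢0′ = begin
  x * y⁻¹                 ≡⟨ sym (*-identityʳ _) ⟩
  x * y⁻¹ * 1ℚ            ≡⟨ cong (x * y⁻¹ *_) (sym (*-inverseʳ v {{≢-nonZero v≢0′}})) ⟩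
  x * y⁻¹ * (v * v⁻¹)     ≡⟨ solve 4 (λ x y⁻¹ v v⁻¹ → x :* y⁻¹ :* (v :* v⁻¹) := (x :* v) :* (y⁻¹ :* v⁻¹)) refl x y⁻¹ v v⁻¹ ⟩
  (x * v) * (y⁻¹ * v⁻¹)   ≡⟨ cong (_* (y⁻¹ * v⁻¹)) xv≡uy ⟩
  (u * y) * (y⁻¹ * v⁻¹)   ≡⟨ solve 4 (λ u y y⁻¹ v⁻¹ → (u :* y) :* (y⁻¹ :* v⁻¹) := u :* v⁻¹ :* (y :* y⁻¹)) refl u y y⁻¹ v⁻¹ ⟩
  u * v⁻¹ * (y * y⁻¹)     ≡⟨ cong (u * v⁻¹ *_) (*-inverseʳ y {{≢-nonZero y≢0′}}) ⟩
  u * v⁻¹ * 1ℚ            ≡⟨ *-identityʳ _ ⟩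
  u * v⁻¹                 ∎
  where
  open ≡-Reasoning
  y⁻¹ = (1/ y) {{≢-nonZero y≢0′}}
  v⁻¹ = (1/ v) {{≢-nonZero v≢0′}}

divℚ-nonNeg : ∀ {x y} → 0ℚ ≤ x → 0ℚ < y → 0ℚ ≤ x divℚ y
divℚ-nonNeg {x} {y} 0≤x 0<y with y ≟ 0ℚ
... | yes _   = ≤-refl
... | no y≢0 = *-nonNeg 0≤x (nonNegative⁻¹ y⁻¹ {{pos⇒nonNeg y⁻¹ {{1/pos⇒pos y {{positive 0<y}}}}}})
  where y⁻¹ = (1/ y) {{≢-nonZero y≢0}}

≤⇒0≤- : ∀ {x y} → x ≤ y → 0ℚ ≤ y - x
≤⇒0≤- {x} {y} x≤y = subst (_≤ y - x) (+-inverseʳ x) (+-monoˡ-≤ (- x) x≤y)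

<⇒0<- : ∀ {x y} → x < y → 0ℚ < y - x
<⇒0<- {x} {y} x<y = subst (_< y - x) (+-inverseʳ x) (+-monoˡ-< (- x) x<y)

parallelWeight : ℚ → ℚ → ℚ
parallelWeight D C = ((C - D) + (C - D)) divℚ ((D + D) - C)

parallelWeight-nonNeg : ∀ {D C} → D ≤ C → C < D + D → 0ℚ ≤ parallelWeight D C
parallelWeight-nonNeg D≤C C<2D = divℚ-nonNeg (+-mono-≤ (≤⇒0≤- D≤C) (≤⇒0≤- D≤C)) (<⇒0<- C<2D)

parallelWeight-ratio : ∀ D C → D ≢ 0ℚ → (D + D) - C ≢ 0ℚ →
                       let d = parallelWeight D C in (1ℚ + d) divℚ (1ℚ + ½ * d) ≡ C divℚ D
parallelWeight-ratio D C D≢0 Y≢0 = divℚ-cross (1ℚ + d) (1ℚ + ½ * d) C D denominator≢0 D≢0 cross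
  where
  open ≡-Reasoning
  d = parallelWeight D C
  -- multiplying by Y turns 1 + d into C and 1 + d/2 into D
  Y = (D + D) - C
  dY≡2[C-D] : d * Y ≡ (C - D) + (C - D)
  dY≡2[C-D] = divℚ-*ʳ _ Y Y≢0
  [1+½d]Y≡D : (1ℚ + ½ * d) * Y ≡ D
  [1+½d]Y≡D = begin
    (1ℚ + ½ * d) * Y              ≡⟨ solve 3 (λ d D C → (con 1ℚ :+ con ½ :* d) :* ((D :+ D) :- C)
                                        := (D :+ D) :- C :+ con ½ :* (d :* ((D :+ D) :- C))) refl d D C ⟩
    Y + ½ * (d * Y)               ≡⟨ cong (λ z → Y + ½ * z) dY≡2[C-D] ⟩
    Y + ½ * ((C - D) + (C - D))   ≡⟨ solve 2 (λ D C → (D :+ D) :- C :+ con ½ :* ((C :- D) :+ (C :- D)) := D) refl D C ⟩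
    D                             ∎
  [1+d]Y≡C : (1ℚ + d) * Y ≡ C
  [1+d]Y≡C = begin
    (1ℚ + d) * Y                  ≡⟨ solve 3 (λ d D C → (con 1ℚ :+ d) :* ((D :+ D) :- C) := (D :+ D) :- C :+ d :* ((D :+ D) :- C)) refl d D C ⟩
    Y + d * Y                     ≡⟨ cong (Y +_) dY≡2[C-D] ⟩
    Y + ((C - D) + (C - D))       ≡⟨ solve 2 (λ D C → (D :+ D) :- C :+ ((C :- D) :+ (C :- D)) := C) refl D C ⟩
    C                             ∎
  denominator≢0 : 1ℚ + ½ * d ≢ 0ℚ
  denominator≢0 e = D≢0 (trans (sym [1+½d]Y≡D) (trans (cong (_* Y) e) (*-zeroˡ Y)))
  cross : (1ℚ + d) * D ≡ C * (1ℚ + ½ * d)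
  cross = begin
    (1ℚ + d) * D                  ≡⟨ cong ((1ℚ + d) *_) [1+½d]Y≡D ⟨
    (1ℚ + d) * ((1ℚ + ½ * d) * Y) ≡⟨ solve 3 (λ d h Y → (con 1ℚ :+ d) :* (h :* Y) := ((con 1ℚ :+ d) :* Y) :* h) refl d (1ℚ + ½ * d) Y ⟩
    ((1ℚ + d) * Y) * (1ℚ + ½ * d) ≡⟨ cong (_* (1ℚ + ½ * d)) [1+d]Y≡C ⟩
    C * (1ℚ + ½ * d)              ∎

∧-true : ∀ {a b} → a ∧ b ≡ true → a ≡ true × b ≡ true
∧-true {a} {b} a∧b = ∧-conicalˡ a b a∧b , ∧-conicalʳ a b a∧b

subsetB-refl : ∀ {n} (A : Subset n) → subsetB A A ≡ true
subsetB-refl []          = refl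
subsetB-refl (false ∷ A) = subsetB-refl A
subsetB-refl (true ∷ A)  = subsetB-refl A

subsetB-trans : ∀ {n} (A B C : Subset n) → subsetB A B ≡ true → subsetB B C ≡ true → subsetB A C ≡ true
subsetB-trans []          []      []          _   _   = refl
subsetB-trans (false ∷ A) (b ∷ B) (c ∷ C)     A⊆B B⊆C =
  subsetB-trans A B C (∧-true A⊆B .proj₂) (∧-true {not b ∨ c} B⊆C .proj₂)
subsetB-trans (true ∷ A)  (true ∷ B) (true ∷ C) A⊆B B⊆C = subsetB-trans A B C A⊆B B⊆C

subsetB-⊥ : ∀ {n} (A : Subset n) → subsetB ⊥ A ≡ true
subsetB-⊥ []      = refl
subsetB-⊥ (_ ∷ A) = subsetB-⊥ A

subsetB-⊥⇒∣∣≡0 : ∀ {n} (B : Subset n) → subsetB B ⊥ ≡ true → ∣ B ∣ ≡ 0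
subsetB-⊥⇒∣∣≡0 []          _   = refl
subsetB-⊥⇒∣∣≡0 (false ∷ B) B⊆⊥ = subsetB-⊥⇒∣∣≡0 B B⊆⊥

subsetB-insertAt : ∀ {n} (A B : Subset n) p {a b} → subsetB A B ≡ true → not a ∨ b ≡ true →
                   subsetB (insertAt A p a) (insertAt B p b) ≡ true
subsetB-insertAt A       B       fzero    A⊆B a⇒b rewrite a⇒b = A⊆B
subsetB-insertAt (x ∷ A) (y ∷ B) (fsuc p) A⊆B a⇒b with ∧-true {not x ∨ y} A⊆B
... | x⇒y , A⊆B′ rewrite x⇒y = subsetB-insertAt A B p A⊆B′ a⇒b

insertAt-⊥-true : ∀ {n} (p : Fin (suc n)) → insertAt ⊥ p true ≡ ⁅ p ⁆
insertAt-⊥-true           fzero    = refl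
insertAt-⊥-true {suc n}   (fsuc p) = cong (false ∷_) (insertAt-⊥-true p)

insertAt-⊥-false : ∀ {n} (p : Fin (suc n)) → insertAt ⊥ p false ≡ ⊥
insertAt-⊥-false           fzero    = refl
insertAt-⊥-false {suc n}   (fsuc p) = cong (false ∷_) (insertAt-⊥-false p)

subsetB-[]≔false : ∀ {n} (B : Subset n) p → subsetB (B [ p ]≔ false) B ≡ true
subsetB-[]≔false (_ ∷ B)     fzero    = subsetB-refl B
subsetB-[]≔false (false ∷ B) (fsuc p) = subsetB-[]≔false B p
subsetB-[]≔false (true ∷ B)  (fsuc p) = subsetB-[]≔false B p

subsetB-[]≔false-insertAt : ∀ {n} (B : Subset (suc n)) (A : Subset n) p → subsetB B (insertAt A p true) ≡ true →
                            subsetB (B [ p ]≔ false) (insertAt A p false) ≡ true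
subsetB-[]≔false-insertAt (b ∷ B) A       fzero    B⊆A+p = ∧-true {not b ∨ true} B⊆A+p .proj₂
subsetB-[]≔false-insertAt (b ∷ B) (a ∷ A) (fsuc p) B⊆A+p with ∧-true {not b ∨ a} B⊆A+p
... | b⇒a , B⊆A+p′ rewrite b⇒a = subsetB-[]≔false-insertAt B A p B⊆A+p′

∣∣≤1+∣[]≔false∣ : ∀ {n} (B : Subset n) p → ∣ B ∣ ℕ.≤ suc ∣ B [ p ]≔ false ∣
∣∣≤1+∣[]≔false∣ (false ∷ B) fzero    = ℕ.n≤1+n _
∣∣≤1+∣[]≔false∣ (true ∷ B)  fzero    = ℕ.≤-refl
∣∣≤1+∣[]≔false∣ (false ∷ B) (fsuc p) = ∣∣≤1+∣[]≔false∣ B p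
∣∣≤1+∣[]≔false∣ (true ∷ B)  (fsuc p) = s≤s (∣∣≤1+∣[]≔false∣ B p)

⊂⁅x⁆⇒≡⊥ : ∀ {n} (D : Subset n) x → D ⊆ ⁅ x ⁆ → D ≢ ⁅ x ⁆ → D ≡ ⊥
⊂⁅x⁆⇒≡⊥ D x D⊆⁅x⁆ D≢⁅x⁆ with x ∈? D
... | yes x∈D = contradiction (⊆-antisym D⊆⁅x⁆ λ y∈⁅x⁆ → subst (_∈ D) (sym (x∈⁅y⁆⇒x≡y x y∈⁅x⁆)) x∈D) D≢⁅x⁆
... | no  x∉D = Empty-unique λ (y , y∈D) → x∉D (subst (_∈ D) (x∈⁅y⁆⇒x≡y x (D⊆⁅x⁆ y∈D)) y∈D)

∈-allSubsets : ∀ n (B : Subset n) → B List.∈ allSubsets n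
∈-allSubsets zero    []          = here refl
∈-allSubsets (suc n) (false ∷ B) = ∈-++⁺ˡ (∈-map⁺ (false ∷_) (∈-allSubsets n B))
∈-allSubsets (suc n) (true ∷ B)  = ∈-++⁺ʳ (List.map (false ∷_) (allSubsets n)) (∈-map⁺ (true ∷_) (∈-allSubsets n B))

maxCard : ∀ {n} → (Subset n → Bool) → List (Subset n) → ℕ
maxCard P Bs = List.foldr _⊔_ 0 (List.map ∣_∣ (List.filterᵇ P Bs))

maxCard-upperBound : ∀ {n} (P : Subset n → Bool) Bs {B} → B List.∈ Bs → P B ≡ true → ∣ B ∣ ℕ.≤ maxCard P Bs
maxCard-upperBound P (_ ∷ Bs) (here refl) PB rewrite PB = ℕ.m≤m⊔n _ _
maxCard-upperBound P (C ∷ Bs) (there B∈Bs) PB with P C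
... | true  = ℕ.≤-trans (maxCard-upperBound P Bs B∈Bs PB) (ℕ.m≤n⊔m _ _)
... | false = maxCard-upperBound P Bs B∈Bs PB

maxCard-least : ∀ {n} (P : Subset n → Bool) Bs {k} → (∀ B → P B ≡ true → ∣ B ∣ ℕ.≤ k) → maxCard P Bs ℕ.≤ k
maxCard-least P []       bound = z≤n
maxCard-least P (C ∷ Bs) bound with P C in PC
... | true  = ℕ.⊔-lub (bound C PC) (maxCard-least P Bs bound)
... | false = maxCard-least P Bs bound

and-map-mono : ∀ {A : Set} (f g : A → Bool) (xs : List A) → (∀ x → f x ≡ true → g x ≡ true) →
               and (List.map f xs) ≡ true → and (List.map g xs) ≡ true
and-map-mono f g []       f⇒g _   = refl
and-map-mono f g (x ∷ xs) f⇒g all with ∧-true {f x} all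
... | fx , rest rewrite f⇒g x fx = and-map-mono f g xs f⇒g rest

module _ {m n : ℕ} (col : Fin n → Vec Bool m) where

  independentB-antitone : ∀ B′ B → subsetB B′ B ≡ true → independentB col B ≡ true → independentB col B′ ≡ true
  independentB-antitone B′ B B′⊆B = and-map-mono _ _ (allSubsets n) noDependenceIn
    where
    noDependenceIn : ∀ C → not (subsetB C B ∧ nonemptyB C ∧ isZeroB (colSum col C)) ≡ true →
                           not (subsetB C B′ ∧ nonemptyB C ∧ isZeroB (colSum col C)) ≡ true
    noDependenceIn C h with subsetB C B′ in C⊆B′
    ... | false = refl
    ... | true rewrite subsetB-trans C B′ B C⊆B′ B′⊆B = h

  binRank-mono : ∀ X Y → subsetB X Y ≡ true → binRank col X ℕ.≤ binRank col Y
  binRank-mono X Y X⊆Y = maxCard-least _ (allSubsets n) λ B h → let (B⊆X , indB) = ∧-true {subsetB B X} h in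
    maxCard-upperBound _ (allSubsets n) (∈-allSubsets n B) (trans (cong (_∧ independentB col B) (subsetB-trans B X Y B⊆X X⊆Y)) indB)

  binRank-⊥ : binRank col ⊥ ≡ 0
  binRank-⊥ = ℕ.n≤0⇒n≡0 (maxCard-least _ (allSubsets n) λ B h → ℕ.≤-reflexive (subsetB-⊥⇒∣∣≡0 B (∧-true {subsetB B ⊥} h .proj₁)))

module _ {m n : ℕ} (col : Fin (suc n) → Vec Bool m) where

  -- Deleting p from an independent B ⊆ A + p leaves an independent subset of A - p.
  binRank-insertAt : ∀ (A : Subset n) p → binRank col (insertAt A p true) ℕ.≤ suc (binRank col (insertAt A p false))
  binRank-insertAt A p = maxCard-least _ (allSubsets (suc n)) λ B h →
    let (B⊆A+p , indB) = ∧-true {subsetB B (insertAt A p true)} h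
        B-p = B [ p ]≔ false
    in ℕ.≤-trans (∣∣≤1+∣[]≔false∣ B p) (s≤s (maxCard-upperBound _ (allSubsets (suc n)) (∈-allSubsets (suc n) B-p)
         (trans (cong (_∧ independentB col B-p) (subsetB-[]≔false-insertAt B A p B⊆A+p))
                (independentB-antitone col B-p B (subsetB-[]≔false B p) indB))))

  binRank-⁅⁆≤1 : ∀ p → binRank col ⁅ p ⁆ ℕ.≤ 1
  binRank-⁅⁆≤1 p = begin
    binRank col ⁅ p ⁆                    ≡⟨ cong (binRank col) (insertAt-⊥-true p) ⟨
    binRank col (insertAt ⊥ p true)       ≤⟨ binRank-insertAt ⊥ p ⟩
    suc (binRank col (insertAt ⊥ p false)) ≡⟨ cong (suc ∘ binRank col) (insertAt-⊥-false p) ⟩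
    suc (binRank col ⊥)                    ≡⟨ cong suc (binRank-⊥ col) ⟩
    1                                      ∎
    where open ℕ.≤-Reasoning

  binRank-⁅⁆-nonLoop : ∀ p → ¬ IsLoop (binRank col) p → binRank col ⁅ p ⁆ ≡ 1
  binRank-⁅⁆-nonLoop p nonLoop with ℕ.n≤1⇒n≡0∨n≡1 (binRank-⁅⁆≤1 p)
  ... | inj₂ r≡1 = r≡1
  ... | inj₁ r≡0 = ⊥-elim (nonLoop (dependent , properSubsetsIndependent))
    where
    dependent : ¬ Independent (binRank col) ⁅ p ⁆
    dependent indep = contradiction (trans (sym r≡0) (trans indep (∣⁅x⁆∣≡1 p))) λ ()
    properSubsetsIndependent : ∀ D → D ⊆ ⁅ p ⁆ → D ≢ ⁅ p ⁆ → Independent (binRank col) D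
    properSubsetsIndependent D D⊆⁅p⁆ D≢⁅p⁆ rewrite ⊂⁅x⁆⇒≡⊥ D p D⊆⁅p⁆ D≢⁅p⁆ = trans (binRank-⊥ col) (sym (∣⊥∣≡0 (suc n)))

sumℚ : ∀ {A : Set} → (A → ℚ) → List A → ℚ
sumℚ f xs = List.foldr _+_ 0ℚ (List.map f xs)

sumℚ-nonNeg : ∀ {A : Set} (f : A → ℚ) xs → (∀ x → 0ℚ ≤ f x) → 0ℚ ≤ sumℚ f xs
sumℚ-nonNeg f []       f≥0 = ≤-refl
sumℚ-nonNeg f (x ∷ xs) f≥0 = subst (_≤ sumℚ f (x ∷ xs)) (+-identityʳ 0ℚ) (+-mono-≤ (f≥0 x) (sumℚ-nonNeg f xs f≥0))

sumℚ-mono : ∀ {A : Set} (f g : A → ℚ) xs → (∀ x → f x ≤ g x) → sumℚ f xs ≤ sumℚ g xs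
sumℚ-mono f g []       f≤g = ≤-refl
sumℚ-mono f g (x ∷ xs) f≤g = +-mono-≤ (f≤g x) (sumℚ-mono f g xs f≤g)

sumℚ-≤-double : ∀ {A : Set} (f g : A → ℚ) xs → (∀ x → g x ≤ f x + f x) → sumℚ g xs ≤ sumℚ f xs + sumℚ f xs
sumℚ-≤-double f g []       g≤2f = ≤-refl
sumℚ-≤-double f g (x ∷ xs) g≤2f = begin
  g x + sumℚ g xs                             ≤⟨ +-mono-≤ (g≤2f x) (sumℚ-≤-double f g xs g≤2f) ⟩
  (f x + f x) + (sumℚ f xs + sumℚ f xs)       ≡⟨ solve 2 (λ a s → (a :+ a) :+ (s :+ s) := (a :+ s) :+ (a :+ s)) refl (f x) (sumℚ f xs) ⟩
  (f x + sumℚ f xs) + (f x + sumℚ f xs)       ∎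
  where open ≤-Reasoning

sumℚ-<-double : ∀ {A : Set} (f g : A → ℚ) {x} xs → x List.∈ xs → g x < f x + f x → (∀ y → g y ≤ f y + f y) →
                sumℚ g xs < sumℚ f xs + sumℚ f xs
sumℚ-<-double f g (y ∷ ys) x∈xs gx<2fx g≤2f = begin-strict
  g y + sumℚ g ys                         <⟨ head+tail x∈xs ⟩
  (f y + f y) + (sumℚ f ys + sumℚ f ys)   ≡⟨ solve 2 (λ a s → (a :+ a) :+ (s :+ s) := (a :+ s) :+ (a :+ s)) refl (f y) (sumℚ f ys) ⟩
  (f y + sumℚ f ys) + (f y + sumℚ f ys)   ∎
  where
  open ≤-Reasoning
  head+tail : _ List.∈ y ∷ ys → g y + sumℚ g ys < (f y + f y) + (sumℚ f ys + sumℚ f ys)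
  head+tail (here refl)  = +-mono-<-≤ gx<2fx (sumℚ-≤-double f g ys g≤2f)
  head+tail (there x∈ys) = +-mono-≤-< (g≤2f y) (sumℚ-<-double f g ys x∈ys gx<2fx g≤2f)

sumℚ-pos : ∀ {A : Set} (f : A → ℚ) {x} xs → x List.∈ xs → 0ℚ < f x → (∀ y → 0ℚ ≤ f y) → 0ℚ < sumℚ f xs
sumℚ-pos f (y ∷ ys) x∈xs fx>0 f≥0 = subst (_< sumℚ f (y ∷ ys)) (+-identityʳ 0ℚ) (head+tail x∈xs)
  where
  head+tail : _ List.∈ y ∷ ys → 0ℚ + 0ℚ < f y + sumℚ f ys
  head+tail (here refl)  = +-mono-<-≤ fx>0 (sumℚ-nonNeg f ys f≥0)
  head+tail (there x∈ys) = +-mono-≤-< (f≥0 y) (sumℚ-pos f ys x∈ys fx>0 f≥0)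

weightOf-nonNeg : ∀ {n} (w : Fin n → ℚ) → (∀ i → 0ℚ ≤ w i) → ∀ A → 0ℚ ≤ weightOf w A
weightOf-nonNeg w w≥0 []      = nonNegative⁻¹ 1ℚ
weightOf-nonNeg w w≥0 (a ∷ A) = *-nonNeg (factor≥0 a) (weightOf-nonNeg (w ∘ fsuc) (w≥0 ∘ fsuc) A)
  where
  factor≥0 : ∀ a → 0ℚ ≤ (if a then w fzero else 1ℚ)
  factor≥0 true  = w≥0 fzero
  factor≥0 false = nonNegative⁻¹ 1ℚ

weightOf-⊥ : ∀ {n} (w : Fin n → ℚ) → weightOf w ⊥ ≡ 1ℚ
weightOf-⊥ {zero}  w = refl
weightOf-⊥ {suc n} w = cong (1ℚ *_) (weightOf-⊥ (w ∘ fsuc))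

halfPow-nonNeg : ∀ k → 0ℚ ≤ halfPow k
halfPow-nonNeg zero    = nonNegative⁻¹ 1ℚ
halfPow-nonNeg (suc k) = *-nonNeg (nonNegative⁻¹ ½) (halfPow-nonNeg k)

≤-+-self : ∀ {x} → 0ℚ ≤ x → x ≤ x + x
≤-+-self {x} x≥0 = subst (_≤ x + x) (+-identityʳ x) (+-monoʳ-≤ x x≥0)

*-halfPow-pred-bounds : ∀ x {k l} → 0ℚ ≤ x → k ℕ.≤ l → l ℕ.≤ suc k → 1 ℕ.≤ l →
                        x * halfPow k ≤ x * halfPow (l ∸ 1) × x * halfPow (l ∸ 1) ≤ x * halfPow k + x * halfPow k
*-halfPow-pred-bounds x {k} x≥0 k≤l l≤1+k 1≤l with ℕ.m≤n⇒m<n∨m≡n k≤l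
... | inj₁ k<l rewrite ℕ.≤-antisym l≤1+k k<l = ≤-refl , ≤-+-self (*-nonNeg x≥0 (halfPow-nonNeg k))
*-halfPow-pred-bounds x {suc j} x≥0 k≤l l≤1+k 1≤l | inj₂ refl =
  subst (x * halfPow (suc j) ≤_) double (≤-+-self (*-nonNeg x≥0 (halfPow-nonNeg (suc j)))) , ≤-reflexive (sym double)
  where
  double : x * halfPow (suc j) + x * halfPow (suc j) ≡ x * halfPow j
  double = solve 2 (λ x h → x :* (con ½ :* h) :+ x :* (con ½ :* h) := x :* h) refl x (halfPow j)

module DeletionContraction {m n : ℕ} (col : Fin (suc n) → Vec Bool m) (γ : Fin (suc n) → ℚ) (p : Fin (suc n))
                           (γ≥0 : ∀ i → 0ℚ ≤ γ i) (nonLoop : ¬ IsLoop (binRank col) p) where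

  r : Subset (suc n) → ℕ
  r = binRank col

  w : Fin n → ℚ
  w = restrictW γ p

  deletionTerm contractionTerm : Subset n → ℚ
  deletionTerm    A = weightOf w A * halfPow (r (insertAt A p false))
  contractionTerm A = weightOf w A * halfPow (r (insertAt A p true) ∸ r ⁅ p ⁆)

  Zdel Zcon : ℚ
  Zdel = Ztilde (deleteR r p) w
  Zcon = Ztilde (contractR r p) w

  term-bounds : ∀ A → deletionTerm A ≤ contractionTerm A × contractionTerm A ≤ deletionTerm A + deletionTerm A
  term-bounds A rewrite binRank-⁅⁆-nonLoop col p nonLoop =
    *-halfPow-pred-bounds (weightOf w A) (weightOf-nonNeg w (γ≥0 ∘ punchIn p) A) A-p≤A+p
      (binRank-insertAt col A p) 1≤A+p
    where
    A-p≤A+p : r (insertAt A p false) ℕ.≤ r (insertAt A p true)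
    A-p≤A+p = binRank-mono col _ _ (subsetB-insertAt A A p (subsetB-refl A) refl)
    1≤A+p : 1 ℕ.≤ r (insertAt A p true)
    1≤A+p = subst (ℕ._≤ r (insertAt A p true))
              (trans (cong r (insertAt-⊥-true p)) (binRank-⁅⁆-nonLoop col p nonLoop))
              (binRank-mono col _ _ (subsetB-insertAt ⊥ A p (subsetB-⊥ A) refl))

  deletionTerm-⊥ : deletionTerm ⊥ ≡ 1ℚ
  deletionTerm-⊥ = cong₂ (λ x k → x * halfPow k) (weightOf-⊥ w) (trans (cong r (insertAt-⊥-false p)) (binRank-⊥ col))

  contractionTerm-⊥ : contractionTerm ⊥ ≡ 1ℚ
  contractionTerm-⊥ = cong₂ (λ x k → x * halfPow k) (weightOf-⊥ w) (trans (cong (λ X → r X ∸ r ⁅ p ⁆) (insertAt-⊥-true p)) (ℕ.n∸n≡0 (r ⁅ p ⁆)))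

  Zdel≤Zcon : Zdel ≤ Zcon
  Zdel≤Zcon = sumℚ-mono deletionTerm contractionTerm (allSubsets n) (proj₁ ∘ term-bounds)

  Zdel>0 : 0ℚ < Zdel
  Zdel>0 = sumℚ-pos deletionTerm (allSubsets n) (∈-allSubsets n ⊥) (subst (0ℚ <_) (sym deletionTerm-⊥) (positive⁻¹ 1ℚ))
             λ A → *-nonNeg (weightOf-nonNeg w (γ≥0 ∘ punchIn p) A) (halfPow-nonNeg (r (insertAt A p false)))

  Zcon<2Zdel : Zcon < Zdel + Zdel
  Zcon<2Zdel = sumℚ-<-double deletionTerm contractionTerm (allSubsets n) (∈-allSubsets n ⊥) ⊥-term (proj₂ ∘ term-bounds)
    where
    ⊥-term : contractionTerm ⊥ < deletionTerm ⊥ + deletionTerm ⊥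
    ⊥-term rewrite contractionTerm-⊥ | deletionTerm-⊥ = from-yes (1ℚ <? 1ℚ + 1ℚ)

Ztilde-I₂-contract : ∀ δ → Ztilde (contractR rankI₂ I₂p) (restrictW δ I₂p) ≡ 1ℚ + δ I₂e
Ztilde-I₂-contract δ = solve 1 (λ x → con 1ℚ :+ (x :* con 1ℚ :* con 1ℚ :+ con 0ℚ) := con 1ℚ :+ x) refl (δ I₂e)

Ztilde-I₂-delete : ∀ δ → Ztilde (deleteR rankI₂ I₂p) (restrictW δ I₂p) ≡ 1ℚ + ½ * δ I₂e
Ztilde-I₂-delete δ = solve 1 (λ x → con 1ℚ :+ (x :* con 1ℚ :* con ½ :+ con 0ℚ) := con 1ℚ :+ con ½ :* x) refl (δ I₂e)

lemma6 : Σ (ℚ → ℚ → ℚ) λ f →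
             (m n : ℕ) (col : Fin (suc n) → Vec Bool m) (γ : Fin (suc n) → ℚ) (p : Fin (suc n)) →
             (∀ i → 0ℚ ≤ γ i) →
             ¬ IsLoop (binRank col) p →
             let Zdel = Ztilde (deleteR (binRank col) p) (restrictW γ p)
                 Zcon = Ztilde (contractR (binRank col) p) (restrictW γ p)
                 d    = f Zdel Zcon
             in 0ℚ ≤ d ×
                ((δ : Fin 2 → ℚ) → (∀ i → 0ℚ ≤ δ i) → δ I₂e ≡ d →
                   (Ztilde (contractR rankI₂ I₂p) (restrictW δ I₂p)
                      divℚ Ztilde (deleteR rankI₂ I₂p) (restrictW δ I₂p))
                   ≡ (Zcon divℚ Zdel))
lemma6 = parallelWeight , λ m n col γ p γ≥0 nonLoop →
  let open DeletionContraction col γ p γ≥0 nonLoop in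
  parallelWeight-nonNeg Zdel≤Zcon Zcon<2Zdel , λ δ _ δe≡d → begin
    Ztilde (contractR rankI₂ I₂p) (restrictW δ I₂p) divℚ Ztilde (deleteR rankI₂ I₂p) (restrictW δ I₂p)
      ≡⟨ cong₂ _divℚ_ (Ztilde-I₂-contract δ) (Ztilde-I₂-delete δ) ⟩
    (1ℚ + δ I₂e) divℚ (1ℚ + ½ * δ I₂e)
      ≡⟨ cong (λ d → (1ℚ + d) divℚ (1ℚ + ½ * d)) δe≡d ⟩
    (1ℚ + parallelWeight Zdel Zcon) divℚ (1ℚ + ½ * parallelWeight Zdel Zcon)
      ≡⟨ parallelWeight-ratio Zdel Zcon (≢-sym (<⇒≢ Zdel>0)) (≢-sym (<⇒≢ (<⇒0<- Zcon<2Zdel))) ⟩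
    Zcon divℚ Zdel ∎
  where open ≡-Reasoning
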